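{- Let $F$ be a finite family of intervals and let $s$ be a minimal bad interval for $F$. Then $F\subseteq (F\downarrow s)^{\cup}$.
   Context: For integers $a<b$, $[a,b)=\{x\in\mathbb{Z}: a\le x<b\}$; an interval is a nonempty set of this form. A family is a finite set of intervals. For a set $s$, $F|s=\{f\in F: f\subseteq s\}$. For an integer $x$, $N_x F$ is the number of members of $F$ containing $x$. An interval $s$ is good for $F$ if $N_x(F|s)\le 1$ for some $x\in s$, and bad otherwise; a minimal bad interval is a bad interval containing no other bad interval. Given an interval $s$, let $[a_1,b_1),\dots,[a_k,b_k)$ be the inclusion-maximal members of $F|s$, ordered so that $a_1<\dots<a_k$ (then $b_1<\dots<b_k$). If $a_{j+1}<b_j$ for $1\le j<k$, the family reduced in $s$ is $F\downarrow s=(F\setminus\{[a_1,b_1),\dots,[a_k,b_k)\})\cup\{[a_2,b_1),\dots,[a_k,b_{k-1})\}$; this condition holds whenever $s$ is a minimal bad interval for $F$, so $F\downarrow s$ is then defined. $G^{\cup}$ denotes the family of all nonempty unions of members of $G$. -}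

module Defs where

open import Data.Integer using (ℤ; _≤_; _<_)
open import Data.Product using (_×_; _,_; proj₁; proj₂; ∃; ∃-syntax; Σ-syntax)
open import Data.Sum using (_⊎_)
open import Data.List using (List; []; _∷_)
open import Data.List.Membership.Propositional using (_∈_; _∉_)
open import Data.List.Relation.Unary.All using (All)
open import Data.List.Relation.Unary.Any using (Any)
open import Data.List.Relation.Unary.Linked using (Linked)
open import Relation.Binary.PropositionalEquality using (_≡_; _≢_)
open import Relation.Nullary using (¬_)
open import Function.Bundles using (_⇔_)

-- An interval [a,b) is represented by its endpoint pair (a , b);
-- it is a genuine (nonempty) interval when a < b.
Itv : Set
Itv = ℤ × ℤ

IsInterval : Itv → Set
IsInterval (a , b) = a < b

_∈I_ : ℤ → Itv → Set
x ∈I (a , b) = (a ≤ x) × (x < b)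

_⊆I_ : Itv → Itv → Set
f ⊆I g = ∀ x → x ∈I f → x ∈I g

-- A family is a finite set of intervals, given as a list (membership = _∈_;
-- duplicates are irrelevant).  F|s is {f ∈ F : f ⊆ s}.
Family : Set
Family = List Itv

IsFamily : Family → Set
IsFamily F = All IsInterval F

_∈R_ : Itv → (Family × Itv) → Set
f ∈R (F , s) = (f ∈ F) × (f ⊆I s)

AtMostOne : Family → Itv → ℤ → Set
AtMostOne F s x = ∀ f g → f ∈R (F , s) → g ∈R (F , s) → x ∈I f → x ∈I g → f ≡ g

Good : Family → Itv → Set
Good F s = ∃[ x ] (x ∈I s × AtMostOne F s x)

Bad : Family → Itv → Set
Bad F s = ¬ Good F s

MinimalBad : Family → Itv → Set
MinimalBad F s = IsInterval s × Bad F s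
  × (∀ t → IsInterval t → t ⊆I s → t ≢ s → Good F t)

IsMaximal : Family → Itv → Itv → Set
IsMaximal F s f = f ∈R (F , s) × (∀ g → g ∈R (F , s) → f ⊆I g → g ≡ f)

MaxList : Family → Itv → List Itv → Set
MaxList F s M = (∀ f → (f ∈ M) ⇔ IsMaximal F s f)
  × Linked (λ p q → proj₁ p < proj₁ q) M

shifts : List Itv → List Itv
shifts (p ∷ q ∷ rest) = (proj₁ q , proj₂ p) ∷ shifts (q ∷ rest)
shifts _ = []

-- membership in F↓s, where M is the ordered list of maximal members of F|s
_∈Red_ : Itv → (Family × List Itv) → Set
g ∈Red (F , M) = ((g ∈ F) × (g ∉ M)) ⊎ (g ∈ shifts M)

InUnions : (Itv → Set) → Itv → Set
InUnions G f = Σ[ g ∈ Itv ] Σ[ L ∈ List Itv ]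
  (All G (g ∷ L) × (∀ x → (x ∈I f) ⇔ Any (x ∈I_) (g ∷ L)))

-- A member f of F that is not maximal in F|s
-- survives in F↓s.  A maximal member f = [a_j, b_j) is the union of the overlaps
-- [a_j, b_{j-1}) and [a_{j+1}, b_j) it shares with its neighbours and of its
-- private part, the points lying in no other maximal member.  A private point x
-- of s is, by badness, contained in some g ∈ F|s other than f; the maximal
-- member above g then contains x, so it is f, hence g ⊆ f is not maximal and
-- survives in F↓s.
module Submission where

open import Data.Empty using (⊥-elim)
open import Data.Integer
  using (ℤ; _≤_; _<_; _≤?_; _<?_; _≟_; +_; _+_; _-_; ∣_∣; 1ℤ; pred)
  renaming (suc to sucℤ)
open import Data.Integer.Properties
open import Data.Integer.Tactic.RingSolver using (solve-∀)
open import Data.List using (List; []; _∷_)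
open import Data.List.Membership.Propositional using (_∈_; _∉_; find; lose)
open import Data.List.Membership.Propositional.Properties using (∈-filter⁺; ∈-filter⁻)
open import Data.List.Relation.Unary.All as All using (All; []; _∷_)
open import Data.List.Relation.Unary.Any using (Any; here; there; any?)
open import Data.List.Relation.Unary.Linked using (Linked; _∷_)
open import Data.Nat using (ℕ; zero; suc)
open import Data.Product using (_×_; _,_; proj₁; proj₂; ∃-syntax)
open import Data.Product.Properties using (≡-dec)
open import Data.Sum using (_⊎_; inj₁; inj₂)
open import Function.Bundles using (Equivalence; mk⇔)
open import Level using (Level)
open import Relation.Binary.Core using (Rel)
open import Relation.Binary.Definitions using (Reflexive; Transitive; Decidable)
open import Relation.Binary.PropositionalEquality
open import Relation.Nullary using (Dec; yes; no; ¬_)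
open import Relation.Nullary.Decidable using (_×-dec_; ¬?)

open import Defs

module MaximalAbove {a ℓ : Level} {A : Set a} (_≼_ : Rel A ℓ)
  (≼-refl : Reflexive _≼_) (≼-trans : Transitive _≼_) (_≼?_ : Decidable _≼_) where

  climb : A → List A → A
  climb x [] = x
  climb x (y ∷ ys) with x ≼? y
  ... | yes _ = climb y ys
  ... | no  _ = climb x ys

  climb-above : ∀ x ys → x ≼ climb x ys
  climb-above x [] = ≼-refl
  climb-above x (y ∷ ys) with x ≼? y
  ... | yes x≼y = ≼-trans x≼y (climb-above y ys)
  ... | no  _   = climb-above x ys

  climb-∈ : ∀ x ys → climb x ys ≡ x ⊎ climb x ys ∈ ys
  climb-∈ x [] = inj₁ refl
  climb-∈ x (y ∷ ys) with x ≼? y | climb-∈ y ys | climb-∈ x ys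
  ... | yes _ | inj₁ eq | _ = inj₂ (here eq)
  ... | yes _ | inj₂ m  | _ = inj₂ (there m)
  ... | no  _ | _ | inj₁ eq = inj₁ eq
  ... | no  _ | _ | inj₂ m  = inj₂ (there m)

  climb-maximal : ∀ x ys {z} → z ∈ ys → climb x ys ≼ z → z ≼ climb x ys
  climb-maximal x (y ∷ ys) z∈ c≼z with x ≼? y | z∈
  ... | yes _   | here refl = climb-above y ys
  ... | yes _   | there z∈ys = climb-maximal y ys z∈ys c≼z
  ... | no x⋠y | here refl = ⊥-elim (x⋠y (≼-trans (climb-above x ys) c≼z))
  ... | no _    | there z∈ys = climb-maximal x ys z∈ys c≼z

  maximal-above : ∀ {x xs} → x ∈ xs →
    ∃[ y ] y ∈ xs × x ≼ y × (∀ {z} → z ∈ xs → y ≼ z → z ≼ y)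
  maximal-above {x} {xs} x∈xs =
    climb x xs , climb∈xs , climb-above x xs , climb-maximal x xs
    where
    climb∈xs : climb x xs ∈ xs
    climb∈xs with climb-∈ x xs
    ... | inj₁ eq = subst (_∈ xs) (sym eq) x∈xs
    ... | inj₂ m  = m

-- Containment of endpoints: it agrees with ⊆I on genuine intervals (⊑⇒⊆I,
-- ⊆I⇒⊑), but unlike ⊆I it is decidable and antisymmetric.
_⊑_ : Itv → Itv → Set
(a , b) ⊑ (c , d) = c ≤ a × b ≤ d

_⊑?_ : Decidable _⊑_
(a , b) ⊑? (c , d) = (c ≤? a) ×-dec (b ≤? d)

⊑-refl : Reflexive _⊑_
⊑-refl = ≤-refl , ≤-refl

⊑-trans : Transitive _⊑_
⊑-trans (c≤a , b≤d) (e≤c , d≤f) = ≤-trans e≤c c≤a , ≤-trans b≤d d≤f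

⊑-antisym : ∀ {p q} → p ⊑ q → q ⊑ p → p ≡ q
⊑-antisym (c≤a , b≤d) (a≤c , d≤b) = cong₂ _,_ (≤-antisym a≤c c≤a) (≤-antisym b≤d d≤b)

⊑⇒⊆I : ∀ {p q} → p ⊑ q → p ⊆I q
⊑⇒⊆I (c≤a , b≤d) x (a≤x , x<b) = ≤-trans c≤a a≤x , <-≤-trans x<b b≤d

⊆I⇒⊑ : ∀ {p q} → IsInterval p → p ⊆I q → p ⊑ q
⊆I⇒⊑ {a , b} {c , d} a<b p⊆q =
  proj₁ (p⊆q a (≤-refl , a<b)) ,
  subst (_≤ d) (suc-pred b) (i<j⇒suc[i]≤j (proj₂ (p⊆q (pred b) pred-b∈p)))
  where
  pred-b∈p : pred b ∈I (a , b)
  pred-b∈p = i<j⇒i≤pred[j] a<b , i≤pred[j]⇒i<j ≤-refl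

_∈I?_ : ∀ x p → Dec (x ∈I p)
x ∈I? (a , b) = (a ≤? x) ×-dec (x <? b)

_≟I_ : (p q : Itv) → Dec (p ≡ q)
_≟I_ = ≡-dec _≟_ _≟_

open import Data.List.Membership.DecPropositional _≟I_ using (_∈?_)

maximal-⊇ : ∀ {F s g} → IsFamily F → g ∈R (F , s) → ∃[ h ] IsMaximal F s h × g ⊆I h
maximal-⊇ {F} {s} fam (g∈F , g⊆s) with maximal-above (∈-filter⁺ (_⊑? s) g∈F g⊑s)
  where
  open MaximalAbove _⊑_ ⊑-refl ⊑-trans _⊑?_
  g⊑s = ⊆I⇒⊑ (All.lookup fam g∈F) g⊆s
... | h , h∈Fs , g⊑h , h-max = h , (h∈R , above-h) , ⊑⇒⊆I g⊑h
  where
  h∈R : h ∈R (F , s)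
  h∈R with ∈-filter⁻ (_⊑? s) h∈Fs
  ... | h∈F , h⊑s = h∈F , ⊑⇒⊆I h⊑s
  above-h : ∀ g' → g' ∈R (F , s) → h ⊆I g' → g' ≡ h
  above-h g' (g'∈F , g'⊆s) h⊆g' =
    ⊑-antisym (h-max (∈-filter⁺ (_⊑? s) g'∈F (⊆I⇒⊑ (All.lookup fam g'∈F) g'⊆s)) h⊑g') h⊑g'
    where
    h⊑g' = ⊆I⇒⊑ (All.lookup fam (proj₁ h∈R)) h⊆g'

maximal-left<⇒right≤ : ∀ {F s f g} → IsMaximal F s f → IsMaximal F s g →
  proj₁ f < proj₁ g → proj₂ f ≤ proj₂ g
maximal-left<⇒right≤ {f = f} {g} (f∈R , _) (_ , g-max) f₁<g₁ with proj₂ f ≤? proj₂ g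
... | yes f₂≤g₂ = f₂≤g₂
... | no  f₂≰g₂ = ⊥-elim (<-irrefl (cong proj₁ f≡g) f₁<g₁)
  where
  f≡g : f ≡ g
  f≡g = g-max f f∈R (⊑⇒⊆I (<⇒≤ f₁<g₁ , <⇒≤ (≰⇒> f₂≰g₂)))

LeftEnd< : Rel Itv _
LeftEnd< p q = proj₁ p < proj₁ q

RightEndsMonotone : List Itv → Set
RightEndsMonotone M = ∀ {p q} → p ∈ M → q ∈ M → LeftEnd< p q → proj₂ p ≤ proj₂ q

linked-head-least : ∀ {q r h} → Linked LeftEnd< (q ∷ r) → h ∈ q ∷ r → proj₁ q ≤ proj₁ h
linked-head-least _ (here refl) = ≤-refl
linked-head-least (q<q' ∷ l) (there h∈r) = ≤-trans (<⇒≤ q<q') (linked-head-least l h∈r)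

shift-or-sole : ∀ {M f x} → Linked LeftEnd< M → RightEndsMonotone M →
  f ∈ M → x ∈I f →
  (∃[ g ] g ∈ shifts M × x ∈I g × g ⊆I f) ⊎ (∀ {h} → h ∈ M → x ∈I h → h ≡ f)
shift-or-sole {p ∷ []} _ _ (here refl) _ = inj₂ λ { (here eq) _ → eq }
shift-or-sole {p ∷ q ∷ r} {x = x} (p<q ∷ l) mono (here refl) (_ , x<b) with proj₁ q ≤? x
... | yes q≤x = inj₁ (_ , here refl , (q≤x , x<b) , ⊑⇒⊆I (<⇒≤ p<q , ≤-refl))
... | no  q≰x = inj₂ λ { (here eq) _ → eq
                      ; (there h∈) (h≤x , _) → ⊥-elim (q≰x (≤-trans (linked-head-least l h∈) h≤x)) }
shift-or-sole {p ∷ q ∷ r} {f} {x} (p<q ∷ l) mono (there f∈) x∈f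
  with shift-or-sole l (λ m m' → mono (there m) (there m')) f∈ x∈f
... | inj₁ (g , g∈ , x∈g , g⊆f) = inj₁ (g , there g∈ , x∈g , g⊆f)
... | inj₂ sole with x <? proj₂ p
...   | no  x≮b = inj₂ λ { (here refl) (_ , x<b) → ⊥-elim (x≮b x<b)
                         ; (there h∈) x∈h → sole h∈ x∈h }
...   | yes x<b = inj₁ (_ , here refl , (q≤x , x<b) , subst (_ ⊆I_) q≡f overlap⊆q)
  where
  q≤x = ≤-trans (linked-head-least l f∈) (proj₁ x∈f)
  b≤b' = mono (here refl) (there (here refl)) p<q
  q≡f = sole (here refl) (q≤x , <-≤-trans x<b b≤b')
  overlap⊆q = ⊑⇒⊆I (≤-refl , b≤b')

points : ℤ → ℕ → List ℤ
points a zero = []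
points a (suc n) = a ∷ points (sucℤ a) n

∈-points : ∀ {a x} n → a ≤ x → x < a + + n → x ∈ points a n
∈-points {a} zero a≤x x<a+0 =
  ⊥-elim (<-irrefl refl (≤-<-trans a≤x (subst (_ <_) (+-identityʳ a) x<a+0)))
∈-points {a} {x} (suc n) a≤x x<a+n+1 with a ≟ x
... | yes refl = here refl
... | no  a≢x  = there (∈-points n (i<j⇒suc[i]≤j (≤∧≢⇒< a≤x a≢x)) (subst (x <_) shift x<a+n+1))
  where
  shift : a + + suc n ≡ sucℤ a + + n
  shift = +-sucʳ a (+ n)
    where
    +-sucʳ : ∀ i j → i + (1ℤ + j) ≡ (1ℤ + i) + j
    +-sucʳ = solve-∀

module _ (G : Itv → Set) (f : Itv) where

  CoveredInside : ℤ → Set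
  CoveredInside x = ∃[ g ] G g × x ∈I g × g ⊆I f

  cover-points : (∀ x → x ∈I f → CoveredInside x) → ∀ xs →
    ∃[ L ] All G L × All (_⊆I f) L × (∀ {x} → x ∈ xs → x ∈I f → Any (x ∈I_) L)
  cover-points w [] = [] , [] , [] , λ ()
  cover-points w (y ∷ ys) with cover-points w ys | y ∈I? f
  ... | L , GL , L⊆f , cov | no y∉f =
    L , GL , L⊆f , λ { (here refl) y∈f → ⊥-elim (y∉f y∈f) ; (there x∈ys) → cov x∈ys }
  ... | L , GL , L⊆f , cov | yes y∈f with w y y∈f
  ...   | g , Gg , y∈g , g⊆f =
    g ∷ L , Gg ∷ GL , g⊆f ∷ L⊆f , λ { (here refl) _ → here y∈g ; (there x∈ys) x∈f → there (cov x∈ys x∈f) }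

  InUnions-fromPointwise : IsInterval f → (∀ x → x ∈I f → CoveredInside x) → InUnions G f
  InUnions-fromPointwise a<b w
    with w (proj₁ f) (≤-refl , a<b) | cover-points w (points (proj₁ f) ∣ proj₂ f - proj₁ f ∣)
  ... | g , Gg , _ , g⊆f | L , GL , L⊆f , cov =
    g , L , Gg ∷ GL , λ x → mk⇔ (λ x∈f → there (cov (enumerated x∈f) x∈f)) (inside (g⊆f ∷ L⊆f))
    where
    a = proj₁ f
    b = proj₂ f
    a+∣b-a∣≡b : a + + ∣ b - a ∣ ≡ b
    a+∣b-a∣≡b = begin
      a + + ∣ b - a ∣ ≡⟨ cong (_+_ a) (0≤i⇒+∣i∣≡i (i≤j⇒0≤j-i (<⇒≤ a<b))) ⟩
      a + (b - a)     ≡⟨ +-cancel-minus a b ⟩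
      b               ∎
      where
      open ≡-Reasoning
      +-cancel-minus : ∀ i j → i + (j - i) ≡ j
      +-cancel-minus = solve-∀
    enumerated : ∀ {x} → x ∈I f → x ∈ points a ∣ b - a ∣
    enumerated (a≤x , x<b) = ∈-points _ a≤x (subst (_ <_) (sym a+∣b-a∣≡b) x<b)
    inside : ∀ {x K} → All (_⊆I f) K → Any (x ∈I_) K → x ∈I f
    inside = All.lookupWith (λ k⊆f x∈k → k⊆f _ x∈k)

another-container : ∀ {F s f x} → IsFamily F → ¬ AtMostOne F s x →
  ∃[ g ] g ∈R (F , s) × x ∈I g × g ≢ f
another-container {F} {s} {f} {x} fam ¬one
  with any? (λ g → (g ⊑? s) ×-dec (x ∈I? g) ×-dec ¬? (g ≟I f)) F
... | yes ∃g with find ∃g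
...   | g , g∈F , g⊑s , x∈g , g≢f = g , (g∈F , ⊑⇒⊆I g⊑s) , x∈g , g≢f
another-container {F} {s} {f} {x} fam ¬one | no ∄g = ⊥-elim (¬one one)
  where
  only-f : ∀ {g} → g ∈R (F , s) → x ∈I g → g ≡ f
  only-f {g} (g∈F , g⊆s) x∈g with g ≟I f
  ... | yes g≡f = g≡f
  ... | no  g≢f = ⊥-elim (∄g (lose g∈F (⊆I⇒⊑ (All.lookup fam g∈F) g⊆s , x∈g , g≢f)))
  one : AtMostOne F s x
  one _ _ g∈R h∈R x∈g x∈h = trans (only-f g∈R x∈g) (sym (only-f h∈R x∈h))

module _ {F : Family} {s : Itv} {M : List Itv} (fam : IsFamily F) (bad : Bad F s)
  (maxList : MaxList F s M) where

  private
    ∈M⇒maximal : ∀ {f} → f ∈ M → IsMaximal F s f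
    ∈M⇒maximal = Equivalence.to (proj₁ maxList _)

    maximal⇒∈M : ∀ {f} → IsMaximal F s f → f ∈ M
    maximal⇒∈M = Equivalence.from (proj₁ maxList _)

    M-rightEndsMonotone : RightEndsMonotone M
    M-rightEndsMonotone p∈M q∈M = maximal-left<⇒right≤ (∈M⇒maximal p∈M) (∈M⇒maximal q∈M)

  reduced-coversInside : ∀ {f x} → f ∈ F → x ∈I f →
    CoveredInside (λ g → g ∈Red (F , M)) f x
  reduced-coversInside {f} {x} f∈F x∈f with f ∈? M
  ... | no f∉M = f , inj₁ (f∈F , f∉M) , x∈f , λ _ y∈f → y∈f
  ... | yes f∈M with shift-or-sole (proj₂ maxList) M-rightEndsMonotone f∈M x∈f
  ...   | inj₁ (g , g∈shifts , x∈g , g⊆f) = g , inj₂ g∈shifts , x∈g , g⊆f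
  ...   | inj₂ sole
    with another-container {f = f} fam (λ one → bad (x , proj₂ (proj₁ (∈M⇒maximal f∈M)) x x∈f , one))
  ...     | g , g∈R , x∈g , g≢f with maximal-⊇ fam g∈R
  ...       | h , h-max , g⊆h = g , inj₁ (proj₁ g∈R , g∉M) , x∈g , g⊆f
    where
    g⊆f : g ⊆I f
    g⊆f = subst (g ⊆I_) (sole (maximal⇒∈M h-max) (g⊆h x x∈g)) g⊆h
    g∉M : g ∉ M
    g∉M g∈M = g≢f (sym (proj₂ (∈M⇒maximal g∈M) f (proj₁ (∈M⇒maximal f∈M)) g⊆f))

mainTheorem4 : (F : Family) (s : Itv) → IsFamily F → MinimalBad F s
    → (M : List Itv) → MaxList F s M
    → ∀ f → f ∈ F → InUnions (λ g → g ∈Red (F , M)) f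
mainTheorem4 F s fam (_ , bad , _) M maxList f f∈F =
  InUnions-fromPointwise _ f (All.lookup fam f∈F)
    (λ _ x∈f → reduced-coversInside fam bad maxList f∈F x∈f)
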